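{- A jointly mono span $X_1\xleftarrow{\pi_1}B\xrightarrow{\pi_2}X_2$ is a $\rho$-bisimulation between $T$-coalgebras $(X_1,\gamma_1)$ and $(X_2,\gamma_2)$ if and only if $(B,\pi_1,\pi_2)\le T^\rho_{\gamma_1,\gamma_2}(B,\pi_1,\pi_2)$ in $\mathrm{Rel}(X_1,X_2)$.
   Context: $P\colon\mathcal C\to\mathcal A$, $S\colon\mathcal A\to\mathcal C$ are contravariant functors forming a dual adjunction (natural bijection $\mathcal C(X,SA)\cong\mathcal A(A,PX)$) with unit $\eta^{\mathcal C}\colon\mathrm{Id}_{\mathcal C}\to SP$. $T\colon\mathcal C\to\mathcal C$ is an endofunctor; a $T$-coalgebra is $(X,\gamma)$ with $\gamma\colon X\to TX$. $(L,\rho)$ is a logic: $L\colon\mathcal A\to\mathcal A$, $\rho\colon LP\to PT$ natural; complex algebra $\gamma^*=P\gamma\circ\rho_X$. Standing assumptions: $\mathcal C$ is finitely complete, well-powered, with an $(\mathcal E,\mathrm{Mono})$-factorisation system; $\mathcal A$ has pullbacks or $\mathcal C$ has pushouts. A span is jointly mono if $\pi_1h=\pi_1h'$ and $\pi_2h=\pi_2h'$ imply $h=h'$; $\mathrm{Rel}(X_1,X_2)$ is the poset of jointly mono spans up to isomorphism with $(B,\pi)\le(B',\pi')$ iff some $k\colon B\to B'$ has $\pi_i=\pi_i'k$. The dual span $(\bar B,\bar\pi_1,\bar\pi_2)$ is the pullback in $\mathcal A$ of $PX_1\xrightarrow{P\pi_1}PB\xleftarrow{P\pi_2}PX_2$;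 $(B,\pi_1,\pi_2)$ is a $\rho$-bisimulation if $P\pi_1\circ\gamma_1^*\circ L\bar\pi_1=P\pi_2\circ\gamma_2^*\circ L\bar\pi_2$. Let $\sigma_i=SL\bar\pi_i\circ S\rho_{X_i}\circ\eta^{\mathcal C}_{TX_i}\colon TX_i\to SL\bar B$; $T^\rho_{\gamma_1,\gamma_2}(B,\pi_1,\pi_2)\in\mathrm{Rel}(X_1,X_2)$ is the pullback in $\mathcal C$ of $X_1\xrightarrow{\sigma_1\circ\gamma_1}SL\bar B\xleftarrow{\sigma_2\circ\gamma_2}X_2$. -}

module Defs where

open import Level using (Level; _⊔_) renaming (suc to lsuc)
open import Data.Product using (Σ; _×_; _,_)
open import Data.Sum using (_⊎_)
open import Relation.Binary using (IsEquivalence)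

record Category (o ℓ e : Level) : Set (lsuc (o ⊔ ℓ ⊔ e)) where
  infixr 9 _∘_
  infix 4 _≈_
  infix 4 _⇒_
  field
    Obj : Set o
    _⇒_ : Obj → Obj → Set ℓ
    _≈_ : ∀ {X Y} → X ⇒ Y → X ⇒ Y → Set e
    id : ∀ {X} → X ⇒ X
    _∘_ : ∀ {X Y Z} → Y ⇒ Z → X ⇒ Y → X ⇒ Z
    equiv : ∀ {X Y} → IsEquivalence (_≈_ {X} {Y})
    ∘-resp-≈ : ∀ {X Y Z} {f f' : Y ⇒ Z} {g g' : X ⇒ Y} →
               f ≈ f' → g ≈ g' → f ∘ g ≈ f' ∘ g'
    assoc : ∀ {W X Y Z} {f : W ⇒ X} {g : X ⇒ Y} {h : Y ⇒ Z} →
            (h ∘ g) ∘ f ≈ h ∘ (g ∘ f)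
    identityˡ : ∀ {X Y} {f : X ⇒ Y} → id ∘ f ≈ f
    identityʳ : ∀ {X Y} {f : X ⇒ Y} → f ∘ id ≈ f

module _ {o ℓ e : Level} (C : Category o ℓ e) where
  open Category C

  IsMono : ∀ {X Y} → X ⇒ Y → Set (o ⊔ ℓ ⊔ e)
  IsMono {X} f = ∀ {Z} (g h : Z ⇒ X) → f ∘ g ≈ f ∘ h → g ≈ h

  IsIso : ∀ {X Y} → X ⇒ Y → Set (ℓ ⊔ e)
  IsIso {X} {Y} f = Σ (Y ⇒ X) λ g → (g ∘ f ≈ id) × (f ∘ g ≈ id)

  JointlyMono : ∀ {B X₁ X₂} → B ⇒ X₁ → B ⇒ X₂ → Set (o ⊔ ℓ ⊔ e)
  JointlyMono {B} π₁ π₂ = ∀ {Z} (h h' : Z ⇒ B) →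
    π₁ ∘ h ≈ π₁ ∘ h' → π₂ ∘ h ≈ π₂ ∘ h' → h ≈ h'

  -- order of Rel(X₁,X₂) on representing spans:
  -- (B,π) ≤ (B',π') iff some k : B → B' has πᵢ = π'ᵢ ∘ k
  SpanLe : ∀ {B B' X₁ X₂} → B ⇒ X₁ → B ⇒ X₂ → B' ⇒ X₁ → B' ⇒ X₂ → Set (ℓ ⊔ e)
  SpanLe {B} {B'} π₁ π₂ π₁' π₂' = Σ (B ⇒ B') λ k → (π₁ ≈ π₁' ∘ k) × (π₂ ≈ π₂' ∘ k)

  record IsPullback {X Y Z Pb : Obj} (f : X ⇒ Z) (g : Y ⇒ Z)
                    (p₁ : Pb ⇒ X) (p₂ : Pb ⇒ Y) : Set (o ⊔ ℓ ⊔ e) where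
    field
      commute : f ∘ p₁ ≈ g ∘ p₂
      universal : ∀ {Q} (q₁ : Q ⇒ X) (q₂ : Q ⇒ Y) → f ∘ q₁ ≈ g ∘ q₂ →
                  Σ (Q ⇒ Pb) λ u → (p₁ ∘ u ≈ q₁) × (p₂ ∘ u ≈ q₂)
      unique : JointlyMono p₁ p₂

  record IsPushout {X Y Z Po : Obj} (f : Z ⇒ X) (g : Z ⇒ Y)
                   (i₁ : X ⇒ Po) (i₂ : Y ⇒ Po) : Set (o ⊔ ℓ ⊔ e) where
    field
      commute : i₁ ∘ f ≈ i₂ ∘ g
      universal : ∀ {Q} (q₁ : X ⇒ Q) (q₂ : Y ⇒ Q) → q₁ ∘ f ≈ q₂ ∘ g →
                  Σ (Po ⇒ Q) λ u → (u ∘ i₁ ≈ q₁) × (u ∘ i₂ ≈ q₂)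
      unique : ∀ {Q} (h h' : Po ⇒ Q) → h ∘ i₁ ≈ h' ∘ i₁ → h ∘ i₂ ≈ h' ∘ i₂ → h ≈ h'

  HasPullbacks : Set (o ⊔ ℓ ⊔ e)
  HasPullbacks = ∀ {X Y Z} (f : X ⇒ Z) (g : Y ⇒ Z) →
    Σ Obj λ Pb → Σ (Pb ⇒ X) λ p₁ → Σ (Pb ⇒ Y) λ p₂ → IsPullback f g p₁ p₂

  HasPushouts : Set (o ⊔ ℓ ⊔ e)
  HasPushouts = ∀ {X Y Z} (f : Z ⇒ X) (g : Z ⇒ Y) →
    Σ Obj λ Po → Σ (X ⇒ Po) λ i₁ → Σ (Y ⇒ Po) λ i₂ → IsPushout f g i₁ i₂

  record IsTerminal (⊤ : Obj) : Set (o ⊔ ℓ ⊔ e) where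
    field
      ! : ∀ {X} → X ⇒ ⊤
      !-unique : ∀ {X} (h : X ⇒ ⊤) → h ≈ !

  FinitelyComplete : Set (o ⊔ ℓ ⊔ e)
  FinitelyComplete = (Σ Obj IsTerminal) × HasPullbacks

  WellPowered : Set (lsuc (o ⊔ ℓ) ⊔ e)
  WellPowered = ∀ (X : Obj) →
    Σ (Set (o ⊔ ℓ)) λ I → Σ (I → Obj) λ S → Σ ((i : I) → S i ⇒ X) λ m →
      ((i : I) → IsMono (m i)) ×
      (∀ {Y} (n : Y ⇒ X) → IsMono n →
         Σ I λ i → Σ (Y ⇒ S i) λ φ → IsIso φ × (m i ∘ φ ≈ n))

  record EMonoFactorisation : Set (lsuc (o ⊔ ℓ ⊔ e)) where
    field
      E : ∀ {X Y} → X ⇒ Y → Set (o ⊔ ℓ ⊔ e)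
      E-isoˡ : ∀ {X Y Z} (f : X ⇒ Y) (i : Y ⇒ Z) → E f → IsIso i → E (i ∘ f)
      E-isoʳ : ∀ {X Y Z} (i : X ⇒ Y) (f : Y ⇒ Z) → IsIso i → E f → E (f ∘ i)
      factor : ∀ {X Y} (f : X ⇒ Y) →
        Σ Obj λ M → Σ (X ⇒ M) λ ε → Σ (M ⇒ Y) λ m → E ε × IsMono m × (m ∘ ε ≈ f)
      diagonal : ∀ {A B X Y} (ε : A ⇒ B) (m : X ⇒ Y) (u : A ⇒ X) (v : B ⇒ Y) →
        E ε → IsMono m → v ∘ ε ≈ m ∘ u →
        Σ (B ⇒ X) λ d → (d ∘ ε ≈ u) × (m ∘ d ≈ v)

module _ {o ℓ e o' ℓ' e' : Level} (C : Category o ℓ e) (D : Category o' ℓ' e') where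
  private
    module C = Category C
    module D = Category D

  record Functor : Set (o ⊔ ℓ ⊔ e ⊔ o' ⊔ ℓ' ⊔ e') where
    field
      F₀ : C.Obj → D.Obj
      F₁ : ∀ {X Y} → X C.⇒ Y → F₀ X D.⇒ F₀ Y
      identity : ∀ {X} → F₁ (C.id {X}) D.≈ D.id
      homomorphism : ∀ {X Y Z} {f : X C.⇒ Y} {g : Y C.⇒ Z} →
                     F₁ (g C.∘ f) D.≈ F₁ g D.∘ F₁ f
      F-resp-≈ : ∀ {X Y} {f g : X C.⇒ Y} → f C.≈ g → F₁ f D.≈ F₁ g

  record ContravariantFunctor : Set (o ⊔ ℓ ⊔ e ⊔ o' ⊔ ℓ' ⊔ e') where
    field
      F₀ : C.Obj → D.Obj
      F₁ : ∀ {X Y} → X C.⇒ Y → F₀ Y D.⇒ F₀ X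
      identity : ∀ {X} → F₁ (C.id {X}) D.≈ D.id
      homomorphism : ∀ {X Y Z} {f : X C.⇒ Y} {g : Y C.⇒ Z} →
                     F₁ (g C.∘ f) D.≈ F₁ f D.∘ F₁ g
      F-resp-≈ : ∀ {X Y} {f g : X C.⇒ Y} → f C.≈ g → F₁ f D.≈ F₁ g

module _ {o ℓ e o' ℓ' e' : Level} (C : Category o ℓ e) (A : Category o' ℓ' e')
         (P : ContravariantFunctor C A) (S : ContravariantFunctor A C) where
  private
    module C = Category C
    module A = Category A
    module P = ContravariantFunctor P
    module S = ContravariantFunctor S

  record DualAdjunction : Set (o ⊔ ℓ ⊔ e ⊔ o' ⊔ ℓ' ⊔ e') where
    field
      Φ : ∀ {X : C.Obj} {a : A.Obj} → X C.⇒ S.F₀ a → a A.⇒ P.F₀ X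
      Ψ : ∀ {X : C.Obj} {a : A.Obj} → a A.⇒ P.F₀ X → X C.⇒ S.F₀ a
      Φ-resp-≈ : ∀ {X a} {h h' : X C.⇒ S.F₀ a} → h C.≈ h' → Φ h A.≈ Φ h'
      Ψ-resp-≈ : ∀ {X a} {k k' : a A.⇒ P.F₀ X} → k A.≈ k' → Ψ k C.≈ Ψ k'
      ΦΨ : ∀ {X a} (k : a A.⇒ P.F₀ X) → Φ (Ψ k) A.≈ k
      ΨΦ : ∀ {X a} (h : X C.⇒ S.F₀ a) → Ψ (Φ h) C.≈ h
      natural : ∀ {X X' a a'} (f : X' C.⇒ X) (g : a' A.⇒ a) (h : X C.⇒ S.F₀ a) →
                Φ (S.F₁ g C.∘ (h C.∘ f)) A.≈ P.F₁ f A.∘ (Φ h A.∘ g)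

    η : ∀ (X : C.Obj) → X C.⇒ S.F₀ (P.F₀ X)
    η X = Ψ (A.id {P.F₀ X})

module Setting {o ℓ e o' ℓ' e' : Level} (C : Category o ℓ e) (A : Category o' ℓ' e')
       (P : ContravariantFunctor C A) (S : ContravariantFunctor A C)
       (adj : DualAdjunction C A P S) (T : Functor C C) where
  private
    module C = Category C
    module A = Category A
    module P = ContravariantFunctor P
    module S = ContravariantFunctor S
    module T = Functor T
    module adj = DualAdjunction adj

  record Coalgebra : Set (o ⊔ ℓ) where
    field
      Carrier : C.Obj
      γ : Carrier C.⇒ T.F₀ Carrier
  open Coalgebra public

  record Logic : Set (o ⊔ ℓ ⊔ o' ⊔ ℓ' ⊔ e') where
    field
      L : Functor A A
      ρ : ∀ (X : C.Obj) → Functor.F₀ L (P.F₀ X) A.⇒ P.F₀ (T.F₀ X)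
      ρ-natural : ∀ {X Y} (f : X C.⇒ Y) →
        ρ X A.∘ Functor.F₁ L (P.F₁ f) A.≈ P.F₁ (T.F₁ f) A.∘ ρ Y

  module _ (lg : Logic) where
    private
      module lg = Logic lg
      module L = Functor lg.L

    complexAlg : (c : Coalgebra) → L.F₀ (P.F₀ (Carrier c)) A.⇒ P.F₀ (Carrier c)
    complexAlg c = P.F₁ (γ c) A.∘ lg.ρ (Carrier c)

    -- ρ-bisimulation condition for the span (B,π₁,π₂) with dual span (B̄,π̄₁,π̄₂)
    IsRhoBisimulation : (c₁ c₂ : Coalgebra) {B : C.Obj}
      (π₁ : B C.⇒ Carrier c₁) (π₂ : B C.⇒ Carrier c₂)
      {B̄ : A.Obj} (π̄₁ : B̄ A.⇒ P.F₀ (Carrier c₁)) (π̄₂ : B̄ A.⇒ P.F₀ (Carrier c₂)) → Set e'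
    IsRhoBisimulation c₁ c₂ π₁ π₂ π̄₁ π̄₂ =
      P.F₁ π₁ A.∘ (complexAlg c₁ A.∘ L.F₁ π̄₁) A.≈ P.F₁ π₂ A.∘ (complexAlg c₂ A.∘ L.F₁ π̄₂)

    σ : (X : C.Obj) {B̄ : A.Obj} (π̄ : B̄ A.⇒ P.F₀ X) → T.F₀ X C.⇒ S.F₀ (L.F₀ B̄)
    σ X π̄ = S.F₁ (L.F₁ π̄) C.∘ (S.F₁ (lg.ρ X) C.∘ adj.η (T.F₀ X))

module Submission where

open import Data.Product using (_,_)
open import Data.Sum using (_⊎_)
open import Function.Bundles using (_⇔_; mk⇔)
open import Function.Construct.Composition using (_⇔-∘_)
open import Relation.Binary using (Setoid; IsEquivalence)
import Relation.Binary.Reasoning.Setoid as SetoidReasoning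

open import Defs

-- The transpose of a ρ-bisimulation leg P πᵢ ∘ γᵢ* ∘ L π̄ᵢ along the dual adjunction is
-- σᵢ ∘ γᵢ ∘ πᵢ. Since transposition is a bijection, (B,π₁,π₂) is a ρ-bisimulation iff the
-- span commutes with the cospan σ₁ ∘ γ₁, σ₂ ∘ γ₂, i.e. iff it factors through its pullback
-- T^ρ(B,π₁,π₂).

hom-setoid : ∀ {o ℓ e} (C : Category o ℓ e) (X Y : Category.Obj C) → Setoid ℓ e
hom-setoid C X Y = record { isEquivalence = Category.equiv C {X} {Y} }

module _ {o ℓ e} (C : Category o ℓ e) where
  open Category C
  private module ≈ {X Y} = IsEquivalence (equiv {X} {Y})

  commutes⇔SpanLe-pullback :
    ∀ {X Y Z Pb B} {f : X ⇒ Z} {g : Y ⇒ Z} {p₁ : Pb ⇒ X} {p₂ : Pb ⇒ Y}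
      {π₁ : B ⇒ X} {π₂ : B ⇒ Y} →
    IsPullback C f g p₁ p₂ → (f ∘ π₁ ≈ g ∘ π₂) ⇔ SpanLe C π₁ π₂ p₁ p₂
  commutes⇔SpanLe-pullback {f = f} {g} {p₁} {p₂} {π₁} {π₂} pb = mk⇔ factor commute-via
    where
    open IsPullback pb
    open SetoidReasoning (hom-setoid C _ _)

    factor : f ∘ π₁ ≈ g ∘ π₂ → SpanLe C π₁ π₂ p₁ p₂
    factor sq with universal π₁ π₂ sq
    ... | u , p₁u≈π₁ , p₂u≈π₂ = u , ≈.sym p₁u≈π₁ , ≈.sym p₂u≈π₂

    commute-via : SpanLe C π₁ π₂ p₁ p₂ → f ∘ π₁ ≈ g ∘ π₂
    commute-via (k , π₁≈p₁k , π₂≈p₂k) = begin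
      f ∘ π₁        ≈⟨ ∘-resp-≈ ≈.refl π₁≈p₁k ⟩
      f ∘ (p₁ ∘ k)  ≈⟨ ≈.sym assoc ⟩
      (f ∘ p₁) ∘ k  ≈⟨ ∘-resp-≈ commute ≈.refl ⟩
      (g ∘ p₂) ∘ k  ≈⟨ assoc ⟩
      g ∘ (p₂ ∘ k)  ≈⟨ ∘-resp-≈ ≈.refl (≈.sym π₂≈p₂k) ⟩
      g ∘ π₂        ∎

module _ {o ℓ e o' ℓ' e'} {C : Category o ℓ e} {A : Category o' ℓ' e'}
         {P : ContravariantFunctor C A} {S : ContravariantFunctor A C}
         (adj : DualAdjunction C A P S) where
  private
    module C = Category C
    module A = Category A
    module P = ContravariantFunctor P
    module S = ContravariantFunctor S
    module ≈C {X Y} = IsEquivalence (C.equiv {X} {Y})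
    module ≈A {X Y} = IsEquivalence (A.equiv {X} {Y})
  open DualAdjunction adj

  Φ-injective : ∀ {X a} {h h' : X C.⇒ S.F₀ a} → Φ h A.≈ Φ h' → h C.≈ h'
  Φ-injective {h = h} {h'} Φh≈Φh' = begin
    h          ≈⟨ ≈C.sym (ΨΦ h) ⟩
    Ψ (Φ h)    ≈⟨ Ψ-resp-≈ Φh≈Φh' ⟩
    Ψ (Φ h')   ≈⟨ ΨΦ h' ⟩
    h'         ∎
    where open SetoidReasoning (hom-setoid C _ _)

  Φ-Sg∘η∘f : ∀ {X Y a} (f : Y C.⇒ X) (g : a A.⇒ P.F₀ X) →
    Φ (S.F₁ g C.∘ (η X C.∘ f)) A.≈ P.F₁ f A.∘ g
  Φ-Sg∘η∘f {X} f g = begin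
    Φ (S.F₁ g C.∘ (η X C.∘ f))   ≈⟨ natural f g (η X) ⟩
    P.F₁ f A.∘ (Φ (η X) A.∘ g)   ≈⟨ A.∘-resp-≈ ≈A.refl (A.∘-resp-≈ (ΦΨ A.id) ≈A.refl) ⟩
    P.F₁ f A.∘ (A.id A.∘ g)      ≈⟨ A.∘-resp-≈ ≈A.refl A.identityˡ ⟩
    P.F₁ f A.∘ g                 ∎
    where open SetoidReasoning (hom-setoid A _ _)

module _ {o ℓ e o' ℓ' e'} {C : Category o ℓ e} {A : Category o' ℓ' e'}
         {P : ContravariantFunctor C A} {S : ContravariantFunctor A C}
         {adj : DualAdjunction C A P S} {T : Functor C C}
         (lg : Setting.Logic C A P S adj T) where
  private
    module C = Category C
    module A = Category A
    module P = ContravariantFunctor P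
    module S = ContravariantFunctor S
    module T = Functor T
    module ≈C {X Y} = IsEquivalence (C.equiv {X} {Y})
    module ≈A {X Y} = IsEquivalence (A.equiv {X} {Y})
    module L = Functor (Setting.Logic.L lg)
  open DualAdjunction adj using (Φ; Φ-resp-≈; η)
  open Setting C A P S adj T
  open Logic lg using (ρ)

  σ∘ : ∀ {X Y B̄} (π̄ : B̄ A.⇒ P.F₀ X) (h : Y C.⇒ T.F₀ X) →
    σ lg X π̄ C.∘ h C.≈ S.F₁ (ρ X A.∘ L.F₁ π̄) C.∘ (η (T.F₀ X) C.∘ h)
  σ∘ {X} π̄ h = begin
    (S.F₁ (L.F₁ π̄) C.∘ (S.F₁ (ρ X) C.∘ η (T.F₀ X))) C.∘ h  ≈⟨ C.assoc ⟩
    S.F₁ (L.F₁ π̄) C.∘ ((S.F₁ (ρ X) C.∘ η (T.F₀ X)) C.∘ h)  ≈⟨ C.∘-resp-≈ ≈C.refl C.assoc ⟩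
    S.F₁ (L.F₁ π̄) C.∘ (S.F₁ (ρ X) C.∘ (η (T.F₀ X) C.∘ h))  ≈⟨ ≈C.sym C.assoc ⟩
    (S.F₁ (L.F₁ π̄) C.∘ S.F₁ (ρ X)) C.∘ (η (T.F₀ X) C.∘ h)  ≈⟨ C.∘-resp-≈ (≈C.sym S.homomorphism) ≈C.refl ⟩
    S.F₁ (ρ X A.∘ L.F₁ π̄) C.∘ (η (T.F₀ X) C.∘ h)           ∎
    where open SetoidReasoning (hom-setoid C _ _)

  Φ-σ∘γ∘π : ∀ (c : Coalgebra) {B B̄} (π : B C.⇒ Carrier c) (π̄ : B̄ A.⇒ P.F₀ (Carrier c)) →
    Φ ((σ lg (Carrier c) π̄ C.∘ γ c) C.∘ π) A.≈ P.F₁ π A.∘ (complexAlg lg c A.∘ L.F₁ π̄)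
  Φ-σ∘γ∘π c π π̄ = begin
    Φ ((σ lg X π̄ C.∘ γ c) C.∘ π)                   ≈⟨ Φ-resp-≈ (≈C.trans C.assoc (σ∘ π̄ (γ c C.∘ π))) ⟩
    Φ (S.F₁ (ρ X A.∘ L.F₁ π̄) C.∘ (η (T.F₀ X) C.∘ (γ c C.∘ π)))
                                                   ≈⟨ Φ-Sg∘η∘f adj (γ c C.∘ π) (ρ X A.∘ L.F₁ π̄) ⟩
    P.F₁ (γ c C.∘ π) A.∘ (ρ X A.∘ L.F₁ π̄)          ≈⟨ A.∘-resp-≈ P.homomorphism ≈A.refl ⟩
    (P.F₁ π A.∘ P.F₁ (γ c)) A.∘ (ρ X A.∘ L.F₁ π̄)   ≈⟨ A.assoc ⟩
    P.F₁ π A.∘ (P.F₁ (γ c) A.∘ (ρ X A.∘ L.F₁ π̄))   ≈⟨ A.∘-resp-≈ ≈A.refl (≈A.sym A.assoc) ⟩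
    P.F₁ π A.∘ (complexAlg lg c A.∘ L.F₁ π̄)        ∎
    where
    X = Carrier c
    open SetoidReasoning (hom-setoid A _ _)

  isRhoBisimulation⇔commutes :
    ∀ (c₁ c₂ : Coalgebra) {B B̄} (π₁ : B C.⇒ Carrier c₁) (π₂ : B C.⇒ Carrier c₂)
      (π̄₁ : B̄ A.⇒ P.F₀ (Carrier c₁)) (π̄₂ : B̄ A.⇒ P.F₀ (Carrier c₂)) →
    IsRhoBisimulation lg c₁ c₂ π₁ π₂ π̄₁ π̄₂
      ⇔ ((σ lg (Carrier c₁) π̄₁ C.∘ γ c₁) C.∘ π₁ C.≈ (σ lg (Carrier c₂) π̄₂ C.∘ γ c₂) C.∘ π₂)
  isRhoBisimulation⇔commutes c₁ c₂ π₁ π₂ π̄₁ π̄₂ =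
    mk⇔ (λ bisim → Φ-injective adj (≈A.trans leg₁ (≈A.trans bisim (≈A.sym leg₂))))
        (λ sq → ≈A.trans (≈A.sym leg₁) (≈A.trans (Φ-resp-≈ sq) leg₂))
    where
    leg₁ : Φ ((σ lg (Carrier c₁) π̄₁ C.∘ γ c₁) C.∘ π₁) A.≈ P.F₁ π₁ A.∘ (complexAlg lg c₁ A.∘ L.F₁ π̄₁)
    leg₁ = Φ-σ∘γ∘π c₁ π₁ π̄₁
    leg₂ : Φ ((σ lg (Carrier c₂) π̄₂ C.∘ γ c₂) C.∘ π₂) A.≈ P.F₁ π₂ A.∘ (complexAlg lg c₂ A.∘ L.F₁ π̄₂)
    leg₂ = Φ-σ∘γ∘π c₂ π₂ π̄₂

theorem3p21 : ∀ {o ℓ e o' ℓ' e'} (C : Category o ℓ e) (A : Category o' ℓ' e') →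
    -- standing assumptions
    FinitelyComplete C → WellPowered C → EMonoFactorisation C →
    (HasPullbacks A ⊎ HasPushouts C) →
    (P : ContravariantFunctor C A) (S : ContravariantFunctor A C)
    (adj : DualAdjunction C A P S) (T : Functor C C) (lg : Setting.Logic C A P S adj T)
    (c₁ c₂ : Setting.Coalgebra C A P S adj T) →
    -- a jointly mono span X₁ ← B → X₂
    {B : Category.Obj C}
    (π₁ : Category._⇒_ C B (Setting.Carrier c₁))
    (π₂ : Category._⇒_ C B (Setting.Carrier c₂)) →
    JointlyMono C π₁ π₂ →
    -- its dual span: a pullback in A of P π₁, P π₂
    {B̄ : Category.Obj A}
    (π̄₁ : Category._⇒_ A B̄ (ContravariantFunctor.F₀ P (Setting.Carrier c₁)))
    (π̄₂ : Category._⇒_ A B̄ (ContravariantFunctor.F₀ P (Setting.Carrier c₂))) →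
    IsPullback A (ContravariantFunctor.F₁ P π₁) (ContravariantFunctor.F₁ P π₂) π̄₁ π̄₂ →
    -- T^ρ(B,π₁,π₂): a pullback in C of σ₁ ∘ γ₁, σ₂ ∘ γ₂
    {D : Category.Obj C}
    (q₁ : Category._⇒_ C D (Setting.Carrier c₁))
    (q₂ : Category._⇒_ C D (Setting.Carrier c₂)) →
    IsPullback C
      (Category._∘_ C (Setting.σ C A P S adj T lg (Setting.Carrier c₁) π̄₁)
                      (Setting.γ c₁))
      (Category._∘_ C (Setting.σ C A P S adj T lg (Setting.Carrier c₂) π̄₂)
                      (Setting.γ c₂))
      q₁ q₂ →
    Setting.IsRhoBisimulation C A P S adj T lg c₁ c₂ π₁ π₂ π̄₁ π̄₂ ⇔ SpanLe C π₁ π₂ q₁ q₂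
theorem3p21 C A _ _ _ _ P S adj T lg c₁ c₂ π₁ π₂ _ π̄₁ π̄₂ _ q₁ q₂ Tρ-pullback =
  commutes⇔SpanLe-pullback C Tρ-pullback ⇔-∘ isRhoBisimulation⇔commutes lg c₁ c₂ π₁ π₂ π̄₁ π̄₂
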